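{- Let $\Delta=2$. For every $n=2^i$ with $i\ge2$, there is a sequence of edge insertions into a graph with $n+1$ vertices, keeping the arboricity at most $2$ before the last insertion, such that the Brodal–Fagerberg algorithm with both adjustments described in the context, when processing the last insertion, blows up the outdegree of some vertex to $\log_2 n$ during the reset cascade.
   Context: Arboricity of $G=(V,E)$: $\max_{U\subseteq V,|U|\ge2}\lceil |E(U)|/(|U|-1)\rceil$. Resetting a vertex means flipping all its outgoing edges so they become incoming. The Brodal–Fagerberg (BF) algorithm with threshold $\Delta$: a deletion removes the edge; an inserted edge is oriented; then, as long as some vertex has outdegree greater than $\Delta$, such a vertex is reset (the reset cascade). The two adjustments: (1) a newly inserted edge is oriented from its endpoint of lower outdegree to its endpoint of higher outdegree; (2) in the reset cascade, the next vertex reset is always one of largest outdegree among vertices with outdegree greater than $\Delta$. -}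

module Defs where

open import Data.Nat using (ℕ; zero; suc; _+_; _*_; _∸_; _≤_; _<_)
open import Data.Bool using (Bool; true; false; _∧_; if_then_else_)
open import Data.Fin using (Fin; _≟_)
open import Data.Fin.Subset using (Subset; ∣_∣)
open import Data.Vec using (lookup)
open import Data.List using (List; []; _∷_; map; length)
open import Data.List.Membership.Propositional using (_∈_)
open import Data.Product using (_×_; _,_; ∃)
open import Data.Sum using (_⊎_)
open import Relation.Nullary using (¬_; does)
open import Relation.Binary.PropositionalEquality using (_≡_)

-- A directed edge (u , v) is oriented u → v.
-- An orientation of a simple graph on N vertices: list of directed edges.
Orientation : ℕ → Set
Orientation N = List (Fin N × Fin N)

outdeg : ∀ {N} → Orientation N → Fin N → ℕ
outdeg [] v = 0
outdeg ((a , b) ∷ es) v = if does (a ≟ v) then suc (outdeg es v) else outdeg es v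

reset : ∀ {N} → Orientation N → Fin N → Orientation N
reset [] v = []
reset ((a , b) ∷ es) v =
  (if does (a ≟ v) then (b , a) else (a , b)) ∷ reset es v

Adjacent : ∀ {N} → Orientation N → Fin N → Fin N → Set
Adjacent s u v = ((u , v) ∈ s) ⊎ ((v , u) ∈ s)

-- Inserting the undirected edge {u,v} (given as a pair) into a simple graph,
-- oriented by adjustment (1): from the endpoint of lower outdegree to the
-- endpoint of higher outdegree (ties: either orientation).
data InsertStep {N : ℕ} (s : Orientation N) : Fin N × Fin N → Orientation N → Set where
  orient-uv : ∀ {u v} → ¬ u ≡ v → ¬ Adjacent s u v →
    outdeg s u ≤ outdeg s v → InsertStep s (u , v) ((u , v) ∷ s)
  orient-vu : ∀ {u v} → ¬ u ≡ v → ¬ Adjacent s u v →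
    outdeg s v ≤ outdeg s u → InsertStep s (u , v) ((v , u) ∷ s)

-- One reset of the cascade, with adjustment (2): the vertex reset has
-- outdegree > Δ and has largest outdegree among such vertices.
ResetStep : ∀ {N} → ℕ → Orientation N → Orientation N → Set
ResetStep {N} Δ s s' = ∃ λ (v : Fin N) →
  Δ < outdeg s v × (∀ w → Δ < outdeg s w → outdeg s w ≤ outdeg s v) × s' ≡ reset s v

data CascadePrefix {N : ℕ} (Δ : ℕ) : Orientation N → Orientation N → Set where
  done : ∀ {s} → CascadePrefix Δ s s
  step : ∀ {s s' s''} → ResetStep Δ s s' → CascadePrefix Δ s' s'' → CascadePrefix Δ s s''

Stable : ∀ {N} → ℕ → Orientation N → Set
Stable Δ s = ∀ v → outdeg s v ≤ Δ

-- A complete execution of BF (threshold Δ, both adjustments) on a sequence of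
-- insertions: each insertion is oriented, then the cascade runs to completion.
data BFRun {N : ℕ} (Δ : ℕ) : Orientation N → List (Fin N × Fin N) → Orientation N → Set where
  []  : ∀ {s} → BFRun Δ s [] s
  _∷_ : ∀ {s e s₁ s₂ es s₃} →
    (InsertStep s e s₁ × CascadePrefix Δ s₁ s₂ × Stable Δ s₂) →
    BFRun Δ s₂ es s₃ → BFRun Δ s (e ∷ es) s₃

edgesIn : ∀ {N} → Subset N → List (Fin N × Fin N) → ℕ
edgesIn U [] = 0
edgesIn U ((a , b) ∷ es) =
  if lookup U a ∧ lookup U b then suc (edgesIn U es) else edgesIn U es

-- Arboricity at most k: for every U with |U| ≥ 2, ⌈|E(U)|/(|U|-1)⌉ ≤ k,
-- written out as |E(U)| ≤ k * (|U| - 1).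
ArboricityAtMost : ∀ {N} → ℕ → List (Fin N × Fin N) → Set
ArboricityAtMost {N} k es =
  ∀ (U : Subset N) → 2 ≤ ∣ U ∣ → edgesIn U es ≤ k * (∣ U ∣ ∸ 1)

module Submission where

-- With M = i ∸ 3, the vertices are 0 … t for t = 2^(M+1) + 1, and every vertex
-- w points to min(w, 2) smaller ones: 1 → 0; 2 → 0, 1; in band m ≥ 1 the vertex
-- j = 2^m + k + 1 points to j - 1 and k + 1; and t → 0, 1.  Then:
--  * inserting these edges in this order never triggers a reset (addVertex),
--    and a downward list with out-degrees at most 2 has arboricity at most 2
--    (insideBelow-bound);
--  * the last edge t → 2^(M+1) overfills t.  After the vertices above a level
--    c have been reset from the top down the list is resetAbove c E, in which
--    exactly the edges crossing c are reversed, so a vertex w ≤ c has gained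
--    its in-edges from above c.  At each level J ≥ 3 vertex J has out-degree
--    at least 3 and is a maximum (pivot), so BF resets t, t - 1, …, 3 in turn;
--  * every band sends an edge into vertex 2 from above, so at level 2 vertex 2
--    has out-degree at least M + 3 ≥ i (two-value).

open import Defs
open import Data.Nat using (ℕ; zero; suc; _+_; _*_; _∸_; _≤_; _<_; _^_; z≤n; s≤s; _≤?_; _<?_)
import Data.Nat as ℕ
open import Data.Nat.Properties
open import Data.Nat.ListAction using (sum)
open import Data.Nat.ListAction.Properties using (sum-++)
open import Data.Fin using (Fin; toℕ) renaming (zero to fzero; suc to fsuc)
import Data.Fin as F
open import Data.Fin.Properties using (toℕ-injective)
open import Data.Fin.Subset using (Subset; ∣_∣)
open import Data.Vec using (lookup; _∷_; [])
open import Data.List using (List; []; _∷_; _++_; _ʳ++_; map)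
open import Data.List.Properties using (map-++; ++-ʳ++)
open import Data.List.Relation.Unary.All using (All; []; _∷_)
import Data.List.Relation.Unary.All as All
open import Data.List.Relation.Unary.All.Properties using (map⁺)
open import Data.List.Relation.Unary.Any.Properties using (reverseAcc⁺)
open import Data.Bool using (Bool; true; false; _∧_; if_then_else_)
open import Data.Bool.Properties using (∧-zeroʳ)
open import Data.List.Relation.Unary.Any using (here; there)
open import Data.List.Membership.Propositional using (_∈_)
open import Data.Product using (_×_; _,_; proj₁; proj₂; map₁; ∃; Σ-syntax; ∃-syntax)
open import Data.Sum using (_⊎_; inj₁; inj₂)
open import Relation.Binary.Definitions using (tri<; tri≈; tri>)
open import Data.Empty using (⊥-elim)
open import Relation.Nullary using (¬_; Dec; yes; no)
open import Relation.Binary.PropositionalEquality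
open import Algebra.Properties.CommutativeSemigroup +-commutativeSemigroup using (interchange)

Edge : Set
Edge = ℕ × ℕ

χ : ∀ {P : Set} → Dec P → ℕ
χ (yes _) = 1
χ (no _)  = 0

χ-yes : ∀ {P : Set} (d : Dec P) → P → χ d ≡ 1
χ-yes (yes _) _ = refl
χ-yes (no ¬p) p = ⊥-elim (¬p p)

χ-no : ∀ {P : Set} (d : Dec P) → ¬ P → χ d ≡ 0
χ-no (yes p) ¬p = ⊥-elim (¬p p)
χ-no (no _)  _  = refl

χ≤1 : ∀ {P : Set} (d : Dec P) → χ d ≤ 1
χ≤1 (yes _) = ≤-refl
χ≤1 (no _)  = z≤n

weight : (Edge → ℕ) → List Edge → ℕ
weight f L = sum (map f L)

weight-++ : ∀ f xs ys → weight f (xs ++ ys) ≡ weight f xs + weight f ys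
weight-++ f xs ys = trans (cong sum (map-++ f xs ys)) (sum-++ (map f xs) (map f ys))

weight-ʳ++ : ∀ f xs ys → weight f (xs ʳ++ ys) ≡ weight f xs + weight f ys
weight-ʳ++ f []       ys = refl
weight-ʳ++ f (x ∷ xs) ys = begin
  weight f (xs ʳ++ x ∷ ys)           ≡⟨ weight-ʳ++ f xs (x ∷ ys) ⟩
  weight f xs + (f x + weight f ys)  ≡⟨ sym (+-assoc (weight f xs) (f x) _) ⟩
  (weight f xs + f x) + weight f ys  ≡⟨ cong (_+ weight f ys) (+-comm (weight f xs) (f x)) ⟩
  (f x + weight f xs) + weight f ys  ∎
  where open ≡-Reasoning

weight-+ : ∀ {f g h} L → (∀ e → f e ≡ g e + h e) → weight f L ≡ weight g L + weight h L
weight-+             []      _  = refl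
weight-+ {f} {g} {h} (e ∷ L) eq = trans (cong₂ _+_ (eq e) (weight-+ L eq))
                                        (interchange (g e) (h e) (weight g L) (weight h L))

weight-mono : ∀ {f g} L → All (λ e → f e ≤ g e) L → weight f L ≤ weight g L
weight-mono []      []       = z≤n
weight-mono (e ∷ L) (h ∷ hs) = +-mono-≤ h (weight-mono L hs)

weight-zero : ∀ {f} L → All (λ e → f e ≡ 0) L → weight f L ≡ 0
weight-zero []      []         = refl
weight-zero (e ∷ L) (z ∷ zeros) = cong₂ _+_ z (weight-zero L zeros)

outℕ : ℕ → List Edge → ℕ
outℕ w = weight (λ e → χ (proj₁ e ℕ.≟ w))

inAbove : ℕ → ℕ → List Edge → ℕ
inAbove c w = weight (λ e → χ (proj₂ e ℕ.≟ w) * χ (c <? proj₁ e))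

Downward : List Edge → Set
Downward = All (λ e → proj₂ e < proj₁ e)

TailsBelow : ℕ → List Edge → Set
TailsBelow k = All (λ e → proj₁ e ≤ k)

∈⇒outℕ : ∀ {x y} L → (x , y) ∈ L → 1 ≤ outℕ x L
∈⇒outℕ {x} (_ ∷ L) (here refl) rewrite χ-yes (x ℕ.≟ x) refl = s≤s z≤n
∈⇒outℕ {x} ((a , _) ∷ L) (there m) = ≤-trans (∈⇒outℕ L m) (m≤n+m _ (χ (a ℕ.≟ x)))

∈-downward : ∀ {x y L} → Downward L → (x , y) ∈ L → y < x
∈-downward (h ∷ _)  (here refl) = h
∈-downward (_ ∷ hs) (there m)   = ∈-downward hs m

notTail : ∀ {x y} L → outℕ x L ≡ 0 → ¬ (x , y) ∈ L
notTail L out≡0 m = 1+n≰n (subst (1 ≤_) out≡0 (∈⇒outℕ L m))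

tailsBelow : ∀ k L → (∀ w → k < w → outℕ w L ≡ 0) → TailsBelow k L
tailsBelow k []            _ = []
tailsBelow k ((a , b) ∷ L) silent with a ≤? k
... | yes a≤k = a≤k ∷ tailsBelow k L (λ w k<w → m+n≡0⇒n≡0 (χ (a ℕ.≟ w)) (silent w k<w))
... | no  a≰k = ⊥-elim (notTail ((a , b) ∷ L) (silent a (≰⇒> a≰k)) (here refl))

All-ʳ++ : ∀ {P : Edge → Set} xs {ys} → All P (xs ʳ++ ys) → All P xs
All-ʳ++ xs {ys} all = All.tabulate (λ m → All.lookup all (reverseAcc⁺ ys xs (inj₂ m)))

member : (ℕ → Bool) → ℕ → ℕ
member u x = if u x then 1 else 0

inside : (ℕ → Bool) → Edge → ℕ
inside u e = if u (proj₁ e) ∧ u (proj₂ e) then 1 else 0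

inside≤1 : ∀ u e → inside u e ≤ 1
inside≤1 u e with u (proj₁ e) ∧ u (proj₂ e)
... | true  = ≤-refl
... | false = z≤n

count : (ℕ → Bool) → ℕ → ℕ
count u zero    = 0
count u (suc k) = count u k + member u k

count-pos : ∀ u k x → u x ≡ true → x < k → 1 ≤ count u k
count-pos u (suc k) x ux x<1+k with x ℕ.≟ k
... | yes refl rewrite ux = m≤n+m 1 (count u x)
... | no x≢k   = ≤-trans (count-pos u k x ux (≤∧≢⇒< (≤-pred x<1+k) x≢k)) (m≤m+n _ _)

count-zero : ∀ u k → count u k ≡ 0 → ∀ x → x < k → u x ≡ false
count-zero u k none x x<k with u x in ux
... | false = refl
... | true  = ⊥-elim (1+n≰n (subst (1 ≤_) none (count-pos u k x ux x<k)))

insideBelow : (ℕ → Bool) → ℕ → List Edge → ℕ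
insideBelow u k = weight (λ e → χ (proj₁ e <? k) * inside u e)

insideFrom : (ℕ → Bool) → ℕ → List Edge → ℕ
insideFrom u k = weight (λ e → χ (proj₁ e ℕ.≟ k) * inside u e)

insideBelow-zero : ∀ u L → insideBelow u 0 L ≡ 0
insideBelow-zero u L = weight-zero L (All.universal (λ e → cong (_* inside u e) (χ-no (proj₁ e <? 0) λ ())) L)

insideBelow-suc : ∀ u k L → insideBelow u (suc k) L ≡ insideBelow u k L + insideFrom u k L
insideBelow-suc u k L = weight-+ L (λ e → trans (cong (_* inside u e) (split (proj₁ e)))
                                                 (*-distribʳ-+ (inside u e) (χ (proj₁ e <? k)) (χ (proj₁ e ℕ.≟ k))))
  where
  split : ∀ a → χ (a <? suc k) ≡ χ (a <? k) + χ (a ℕ.≟ k)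
  split a with <-cmp a k
  ... | tri< a<k a≢k _ rewrite χ-yes (a <? suc k) (m≤n⇒m≤1+n a<k) | χ-yes (a <? k) a<k | χ-no (a ℕ.≟ k) a≢k = refl
  ... | tri≈ a≮k a≡k _ rewrite χ-yes (a <? suc k) (s≤s (≤-reflexive a≡k)) | χ-no (a <? k) a≮k | χ-yes (a ℕ.≟ k) a≡k = refl
  ... | tri> a≮k a≢k _ rewrite χ-no (a <? suc k) (λ a<1+k → a≮k (≤∧≢⇒< (≤-pred a<1+k) a≢k))
                             | χ-no (a <? k) a≮k | χ-no (a ℕ.≟ k) a≢k = refl

insideFrom≤outℕ : ∀ u k L → insideFrom u k L ≤ outℕ k L
insideFrom≤outℕ u k L = weight-mono L (All.universal (λ e →
  ≤-trans (*-monoʳ-≤ (χ (proj₁ e ℕ.≟ k)) (inside≤1 u e)) (≤-reflexive (*-identityʳ _))) L)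

insideFrom-nonmember : ∀ u k L → u k ≡ false → insideFrom u k L ≡ 0
insideFrom-nonmember u k L uk≡false = weight-zero L (All.universal edge L)
  where
  edge : ∀ e → χ (proj₁ e ℕ.≟ k) * inside u e ≡ 0
  edge (a , b) with a ℕ.≟ k
  ... | no _     = refl
  ... | yes refl rewrite uk≡false = refl

insideFrom-lowest : ∀ u k L → Downward L → (∀ b → b < k → u b ≡ false) → insideFrom u k L ≡ 0
insideFrom-lowest u k L downward none = weight-zero L (All.map edge downward)
  where
  edge : ∀ {e} → proj₂ e < proj₁ e → χ (proj₁ e ℕ.≟ k) * inside u e ≡ 0
  edge {a , b} b<a with a ℕ.≟ k
  ... | no _     = refl
  ... | yes refl rewrite none b b<a | ∧-zeroʳ (u a) = refl

-- The degeneracy bound: in a downward list with out-degrees at most d, a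
-- vertex set containing c ≥ 1 of the vertices below k spans at most
-- d (c - 1) edges with tails below k, since its lowest member contributes
-- no inside edge and every other member at most d.
insideBelow-bound : ∀ d u L → Downward L → (∀ w → outℕ w L ≤ d) → ∀ k → insideBelow u k L ≤ d * (count u k ∸ 1)
insideBelow-bound d u L downward out≤d zero rewrite insideBelow-zero u L = z≤n
insideBelow-bound d u L downward out≤d (suc k) rewrite insideBelow-suc u k L = byMembership (u k) refl
  where
  IH : insideBelow u k L ≤ d * (count u k ∸ 1)
  IH = insideBelow-bound d u L downward out≤d k
  byMembership : ∀ x → u k ≡ x → insideBelow u k L + insideFrom u k L ≤ d * (count u k + member u k ∸ 1)
  byMembership false uk rewrite uk | insideFrom-nonmember u k L uk | +-identityʳ (insideBelow u k L)
                              | +-identityʳ (count u k) = IH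
  byMembership true uk rewrite uk = byCount (count u k) refl
    where
    byCount : ∀ c → count u k ≡ c → insideBelow u k L + insideFrom u k L ≤ d * (count u k + 1 ∸ 1)
    byCount zero c≡0 rewrite c≡0 | insideFrom-lowest u k L downward (count-zero u k c≡0)
                           | +-identityʳ (insideBelow u k L) =
      subst (λ c → insideBelow u k L ≤ d * (c ∸ 1)) c≡0 IH
    byCount (suc c) c≡1+c rewrite c≡1+c =
      ≤-trans (+-mono-≤ (subst (λ c → insideBelow u k L ≤ d * (c ∸ 1)) c≡1+c IH)
                        (≤-trans (insideFrom≤outℕ u k L) (out≤d k)))
              (≤-reflexive (trans (cong (d * c +_) (sym (*-identityʳ d))) (sym (*-distribˡ-+ d c 1))))

count-shift : ∀ u m → count u (suc m) ≡ member u 0 + count (λ k → u (suc k)) m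
count-shift u zero    = sym (+-identityʳ (member u 0))
count-shift u (suc m) rewrite count-shift u m = +-assoc (member u 0) _ _

-- Vertex k as an element of Fin (suc n), clamped to n (only used for k ≤ n).
toFin : ∀ n → ℕ → Fin (suc n)
toFin n       zero    = fzero
toFin zero    (suc k) = fzero
toFin (suc n) (suc k) = fsuc (toFin n k)

toℕ-toFin : ∀ n k → k ≤ n → toℕ (toFin n k) ≡ k
toℕ-toFin n       zero    _         = refl
toℕ-toFin (suc n) (suc k) (s≤s k≤n) = cong suc (toℕ-toFin n k k≤n)

∣∣≡count : ∀ n (U : Subset (suc n)) → ∣ U ∣ ≡ count (λ k → lookup U (toFin n k)) (suc n)
∣∣≡count zero    (true  ∷ []) = refl
∣∣≡count zero    (false ∷ []) = refl
∣∣≡count (suc n) (b ∷ U) = trans (head b) (sym (count-shift (λ k → lookup (b ∷ U) (toFin (suc n) k)) (suc n)))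
  where
  head : ∀ b → ∣ b ∷ U ∣ ≡ member (λ _ → b) 0 + count (λ k → lookup U (toFin n k)) (suc n)
  head true  = cong suc (∣∣≡count n U)
  head false = ∣∣≡count n U

resetEdge : ℕ → Edge → Edge
resetEdge v (a , b) with a ℕ.≟ v
... | yes _ = (b , a)
... | no _  = (a , b)

resetℕ : List Edge → ℕ → List Edge
resetℕ L v = map (resetEdge v) L

resetEdge-tail : ∀ a b → resetEdge a (a , b) ≡ (b , a)
resetEdge-tail a b with a ℕ.≟ a
... | yes _ = refl
... | no a≢a = ⊥-elim (a≢a refl)

resetEdge-other : ∀ a b v → ¬ a ≡ v → resetEdge v (a , b) ≡ (a , b)
resetEdge-other a b v a≢v with a ℕ.≟ v
... | yes a≡v = ⊥-elim (a≢v a≡v)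
... | no _    = refl

module Embedding (n : ℕ) where

  V : Set
  V = Fin (suc n)

  vtx : ℕ → V
  vtx = toFin n

  embed : List Edge → Orientation (suc n)
  embed = map (λ e → vtx (proj₁ e) , vtx (proj₂ e))

  InRange : List Edge → Set
  InRange = All (λ e → proj₁ e ≤ n × proj₂ e ≤ n)

  vtx-injective : ∀ {a b} → a ≤ n → b ≤ n → vtx a ≡ vtx b → a ≡ b
  vtx-injective {a} {b} a≤n b≤n eq =
    trans (sym (toℕ-toFin n a a≤n)) (trans (cong toℕ eq) (toℕ-toFin n b b≤n))

  outdeg-embed : ∀ L → InRange L → (w : V) → outdeg (embed L) w ≡ outℕ (toℕ w) L
  outdeg-embed []            _                w = refl
  outdeg-embed ((a , b) ∷ L) ((a≤n , _) ∷ rs) w with vtx a F.≟ w | a ℕ.≟ toℕ w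
  ... | yes _ | yes _ = cong suc (outdeg-embed L rs w)
  ... | no _  | no _  = outdeg-embed L rs w
  ... | yes p | no q  = ⊥-elim (q (trans (sym (toℕ-toFin n a a≤n)) (cong toℕ p)))
  ... | no p  | yes q = ⊥-elim (p (toℕ-injective (trans (toℕ-toFin n a a≤n) q)))

  reset-embed : ∀ L → InRange L → ∀ v → v ≤ n → reset (embed L) (vtx v) ≡ embed (resetℕ L v)
  reset-embed []            _                v v≤n = refl
  reset-embed ((a , b) ∷ L) ((a≤n , _) ∷ rs) v v≤n with vtx a F.≟ vtx v | a ℕ.≟ v
  ... | yes _ | yes _ = cong (_ ∷_) (reset-embed L rs v v≤n)
  ... | no _  | no _  = cong (_ ∷_) (reset-embed L rs v v≤n)
  ... | yes p | no q  = ⊥-elim (q (vtx-injective a≤n v≤n p))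
  ... | no p  | yes q = ⊥-elim (p (cong vtx q))

  ∈-embed : ∀ {L a b} → InRange L → a ≤ n → b ≤ n → (vtx a , vtx b) ∈ embed L → (a , b) ∈ L
  ∈-embed {_ ∷ _} ((a'≤n , b'≤n) ∷ _) a≤n b≤n (here eq) =
    here (cong₂ _,_ (vtx-injective a≤n a'≤n (cong proj₁ eq)) (vtx-injective b≤n b'≤n (cong proj₂ eq)))
  ∈-embed {_ ∷ _} (_ ∷ rs) a≤n b≤n (there m) = there (∈-embed rs a≤n b≤n m)

  members : Subset (suc n) → ℕ → Bool
  members U k = lookup U (vtx k)

  edgesIn-embed : ∀ U L → InRange L → edgesIn U (embed L) ≡ insideBelow (members U) (suc n) L
  edgesIn-embed U []            []               = refl
  edgesIn-embed U ((a , b) ∷ L) ((a≤n , _) ∷ rs) rewrite χ-yes (a <? suc n) (s≤s a≤n) | edgesIn-embed U L rs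
    with lookup U (vtx a) ∧ lookup U (vtx b)
  ... | true  = refl
  ... | false = refl

  arboricity-embed : ∀ d L → InRange L → Downward L → (∀ w → outℕ w L ≤ d) → ArboricityAtMost d (embed L)
  arboricity-embed d L rs downward out≤d U _ =
    subst₂ (λ x c → x ≤ d * (c ∸ 1)) (sym (edgesIn-embed U L rs)) (sym (∣∣≡count n U))
           (insideBelow-bound d (members U) L downward out≤d (suc n))

-- Inserting the edge a → b into acc is quiet for threshold Δ: the insertion is
-- legal, the lower-outdegree rule allows orienting it a → b, and afterwards
-- every out-degree is at most Δ, so the reset cascade is empty.
record QuietStep (Δ : ℕ) (acc : List Edge) (a b : ℕ) : Set where
  field
    loopless : ¬ a ≡ b
    fresh    : ¬ (a , b) ∈ acc
    freshRev : ¬ (b , a) ∈ acc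
    tailLow  : outℕ a acc ≤ outℕ b acc
    bounded  : ∀ w → outℕ w ((a , b) ∷ acc) ≤ Δ

data Quiet (Δ : ℕ) : List Edge → List Edge → Set where
  []  : ∀ {acc} → Quiet Δ acc []
  _∷_ : ∀ {acc a b L} → QuietStep Δ acc a b → Quiet Δ ((a , b) ∷ acc) L → Quiet Δ acc ((a , b) ∷ L)

Quiet-++ : ∀ {Δ acc} L₁ {L₂} → Quiet Δ acc L₁ → Quiet Δ (L₁ ʳ++ acc) L₂ → Quiet Δ acc (L₁ ++ L₂)
Quiet-++ []            []       q₂ = q₂
Quiet-++ ((a , b) ∷ L₁) (q ∷ qs) q₂ = q ∷ Quiet-++ L₁ qs q₂

module QuietRun (n : ℕ) where
  open Embedding n

  quiet⇒BFRun : ∀ {Δ} L acc → InRange L → InRange acc → Quiet Δ acc L →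
                BFRun Δ (embed acc) (embed L) (embed (L ʳ++ acc))
  quiet⇒BFRun []            acc _                    _   []       = []
  quiet⇒BFRun ((a , b) ∷ L) acc ((a≤n , b≤n) ∷ rsL) rsA (q ∷ qs) =
    (insert , done , stable) ∷ quiet⇒BFRun L ((a , b) ∷ acc) rsL ((a≤n , b≤n) ∷ rsA) qs
    where
    open QuietStep q
    lowerTail : outdeg (embed acc) (vtx a) ≤ outdeg (embed acc) (vtx b)
    lowerTail rewrite outdeg-embed acc rsA (vtx a) | outdeg-embed acc rsA (vtx b)
                    | toℕ-toFin n a a≤n | toℕ-toFin n b b≤n = tailLow
    nonAdjacent : ¬ Adjacent (embed acc) (vtx a) (vtx b)
    nonAdjacent (inj₁ m) = fresh (∈-embed rsA a≤n b≤n m)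
    nonAdjacent (inj₂ m) = freshRev (∈-embed rsA b≤n a≤n m)
    insert : InsertStep (embed acc) (vtx a , vtx b) (embed ((a , b) ∷ acc))
    insert = orient-uv (λ e → loopless (vtx-injective a≤n b≤n e)) nonAdjacent lowerTail
    stable : Stable _ (embed ((a , b) ∷ acc))
    stable v rewrite outdeg-embed ((a , b) ∷ acc) ((a≤n , b≤n) ∷ rsA) v = bounded (toℕ v)

-- The orientation of a downward edge a → b after every vertex above c has
-- been reset, from the top down: the edge is reversed exactly when it
-- crosses c (a > c ≥ b); an edge with both ends above c is reset twice.
orientAt : ℕ → Edge → Edge
orientAt c (a , b) with c <? a | c <? b
... | yes _ | no _  = (b , a)
... | yes _ | yes _ = (a , b)
... | no _  | _     = (a , b)

orientAt-cross : ∀ c a b → c < a → ¬ c < b → orientAt c (a , b) ≡ (b , a)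
orientAt-cross c a b c<a c≮b with c <? a | c <? b
... | yes _ | no _    = refl
... | yes _ | yes c<b = ⊥-elim (c≮b c<b)
... | no c≮a | _      = ⊥-elim (c≮a c<a)

orientAt-low : ∀ c a b → ¬ c < a → orientAt c (a , b) ≡ (a , b)
orientAt-low c a b c≮a with c <? a | c <? b
... | yes c<a | _ = ⊥-elim (c≮a c<a)
... | no _    | _ = refl

orientAt-high : ∀ c a b → c < b → orientAt c (a , b) ≡ (a , b)
orientAt-high c a b c<b with c <? a | c <? b
... | yes _ | no c≮b = ⊥-elim (c≮b c<b)
... | yes _ | yes _  = refl
... | no _  | _      = refl

resetAbove : ℕ → List Edge → List Edge
resetAbove c = map (orientAt c)

orientAt-reset : ∀ c a b → b < a → resetEdge (suc c) (orientAt (suc c) (a , b)) ≡ orientAt c (a , b)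
orientAt-reset c a b b<a = byCases (suc c <? a) (suc c <? b) (b ℕ.≟ suc c) (a ℕ.≟ suc c)
  where
  byCases : Dec (suc c < a) → Dec (suc c < b) → Dec (b ≡ suc c) → Dec (a ≡ suc c) →
            resetEdge (suc c) (orientAt (suc c) (a , b)) ≡ orientAt c (a , b)
  byCases (yes c+1<a) (yes c+1<b) _ _
    rewrite orientAt-high (suc c) a b c+1<b
          | resetEdge-other a b (suc c) (λ e → <-irrefl (sym e) c+1<a) =
    sym (orientAt-high c a b (<-trans (n<1+n c) c+1<b))
  byCases (yes c+1<a) (no c+1≮b) (yes refl) _
    rewrite orientAt-cross (suc c) a b c+1<a c+1≮b | resetEdge-tail (suc c) a =
    sym (orientAt-high c a (suc c) (n<1+n c))
  byCases (yes c+1<a) (no c+1≮b) (no b≢c+1) _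
    rewrite orientAt-cross (suc c) a b c+1<a c+1≮b | resetEdge-other b a (suc c) b≢c+1 =
    sym (orientAt-cross c a b (<-trans (n<1+n c) c+1<a) (λ c<b → b≢c+1 (≤-antisym (≮⇒≥ c+1≮b) c<b)))
  byCases (no c+1≮a) _ _ (yes refl)
    rewrite orientAt-low (suc c) (suc c) b c+1≮a | resetEdge-tail (suc c) b =
    sym (orientAt-cross c (suc c) b (n<1+n c) (λ c<b → <-irrefl refl (<-≤-trans b<a c<b)))
  byCases (no c+1≮a) _ _ (no a≢c+1)
    rewrite orientAt-low (suc c) a b c+1≮a | resetEdge-other a b (suc c) a≢c+1 =
    sym (orientAt-low c a b (λ c<a → a≢c+1 (≤-antisym (≮⇒≥ c+1≮a) c<a)))

resetAbove-step : ∀ c E → Downward E → resetℕ (resetAbove (suc c) E) (suc c) ≡ resetAbove c E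
resetAbove-step c []            []       = refl
resetAbove-step c ((a , b) ∷ E) (h ∷ hs) = cong₂ _∷_ (orientAt-reset c a b h) (resetAbove-step c E hs)

resetAbove-top : ∀ c E → TailsBelow c E → resetAbove c E ≡ E
resetAbove-top c []            []       = refl
resetAbove-top c ((a , b) ∷ E) (h ∷ hs) = cong₂ _∷_ (orientAt-low c a b (≤⇒≯ h)) (resetAbove-top c E hs)

outℕ-resetAbove-low : ∀ c w E → Downward E → w ≤ c → outℕ w (resetAbove c E) ≡ outℕ w E + inAbove c w E
outℕ-resetAbove-low c w []            []       _   = refl
outℕ-resetAbove-low c w ((a , b) ∷ E) (h ∷ hs) w≤c =
  trans (cong₂ _+_ (edge (c <? a) (c <? b)) (outℕ-resetAbove-low c w E hs w≤c))
        (interchange (χ (a ℕ.≟ w)) (χ (b ℕ.≟ w) * χ (c <? a)) (outℕ w E) (inAbove c w E))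
  where
  notAbove : ∀ {x} → c < x → ¬ x ≡ w
  notAbove c<x refl = <-irrefl refl (≤-<-trans w≤c c<x)
  edge : Dec (c < a) → Dec (c < b) →
         χ (proj₁ (orientAt c (a , b)) ℕ.≟ w) ≡ χ (a ℕ.≟ w) + χ (b ℕ.≟ w) * χ (c <? a)
  edge (yes c<a) (no c≮b)
    rewrite orientAt-cross c a b c<a c≮b | χ-no (a ℕ.≟ w) (notAbove c<a) | χ-yes (c <? a) c<a =
    sym (*-identityʳ _)
  edge (yes c<a) (yes c<b)
    rewrite orientAt-high c a b c<b | χ-no (b ℕ.≟ w) (notAbove c<b) = sym (+-identityʳ _)
  edge (no c≮a) _
    rewrite orientAt-low c a b c≮a | χ-no (c <? a) c≮a | *-zeroʳ (χ (b ℕ.≟ w)) = sym (+-identityʳ _)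

outℕ-resetAbove-high : ∀ c w E → Downward E → c < w → outℕ w (resetAbove c E) ≤ outℕ w E
outℕ-resetAbove-high c w []            []       _   = z≤n
outℕ-resetAbove-high c w ((a , b) ∷ E) (h ∷ hs) c<w =
  +-mono-≤ (edge (c <? a) (c <? b)) (outℕ-resetAbove-high c w E hs c<w)
  where
  edge : Dec (c < a) → Dec (c < b) → χ (proj₁ (orientAt c (a , b)) ℕ.≟ w) ≤ χ (a ℕ.≟ w)
  edge (yes c<a) (no c≮b)
    rewrite orientAt-cross c a b c<a c≮b | χ-no (b ℕ.≟ w) (λ { refl → c≮b c<w }) = z≤n
  edge (yes c<a) (yes c<b) rewrite orientAt-high c a b c<b = ≤-refl
  edge (no c≮a) _          rewrite orientAt-low c a b c≮a  = ≤-refl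

orientAt-endpoints : ∀ c a b → orientAt c (a , b) ≡ (a , b) ⊎ orientAt c (a , b) ≡ (b , a)
orientAt-endpoints c a b with c <? a | c <? b
... | yes _ | no _  = inj₂ refl
... | yes _ | yes _ = inj₁ refl
... | no _  | _     = inj₁ refl

1≤2^ : ∀ m → 1 ≤ 2 ^ m
1≤2^ m = m^n>0 2 m

2^-suc : ∀ m → 2 ^ suc m ≡ 2 ^ m + 2 ^ m
2^-suc m = cong (2 ^ m +_) (+-identityʳ (2 ^ m))

2≤2^suc : ∀ m → 2 ≤ 2 ^ suc m
2≤2^suc m rewrite 2^-suc m = +-mono-≤ (1≤2^ m) (1≤2^ m)

-- The out-degree min(w, 2) every vertex w receives in the construction.
cap : ℕ → ℕ
cap zero          = 0
cap (suc zero)    = 1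
cap (suc (suc _)) = 2

cap≤2 : ∀ w → cap w ≤ 2
cap≤2 zero          = z≤n
cap≤2 (suc zero)    = s≤s z≤n
cap≤2 (suc (suc _)) = ≤-refl

cap-≥2 : ∀ {w} → 2 ≤ w → cap w ≡ 2
cap-≥2 {suc zero}    (s≤s ())
cap-≥2 {suc (suc _)} _ = refl

cap-≥1 : ∀ {w} → 1 ≤ w → 1 ≤ cap w
cap-≥1 {suc zero}    _ = ≤-refl
cap-≥1 {suc (suc _)} _ = s≤s z≤n

-- Out-degree of w once the vertices 0 … j-1 have been inserted.
expected : ℕ → ℕ → ℕ
expected j w = χ (w <? j) * cap w

expected-below : ∀ {j w} → w < j → expected j w ≡ cap w
expected-below {j} {w} w<j rewrite χ-yes (w <? j) w<j = +-identityʳ (cap w)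

expected-above : ∀ {j w} → ¬ w < j → expected j w ≡ 0
expected-above {j} {w} w≮j rewrite χ-no (w <? j) w≮j = refl

expected≤2 : ∀ j w → expected j w ≤ 2
expected≤2 j w = ≤-trans (*-monoˡ-≤ (cap w) (χ≤1 (w <? j)))
                         (≤-trans (≤-reflexive (+-identityʳ (cap w))) (cap≤2 w))

expected-suc : ∀ {j w} → ¬ j ≡ w → expected j w ≡ expected (suc j) w
expected-suc {j} {w} j≢w = byCases (w <? j)
  where
  byCases : Dec (w < j) → expected j w ≡ expected (suc j) w
  byCases (yes w<j) = trans (expected-below w<j) (sym (expected-below (m≤n⇒m≤1+n w<j)))
  byCases (no w≮j)  = trans (expected-above w≮j)
    (sym (expected-above (λ w<1+j → w≮j (≤∧≢⇒< (≤-pred w<1+j) (λ w≡j → j≢w (sym w≡j))))))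

record Built (j : ℕ) (acc : List Edge) : Set where
  field
    downward : Downward acc
    degree   : ∀ w → outℕ w acc ≡ expected j w
open Built

Built-fresh : ∀ {j acc} → Built j acc → outℕ j acc ≡ 0
Built-fresh {j} b = trans (degree b j) (expected-above {j} {j} (<-irrefl refl))

Built-tails : ∀ {k acc} → Built (suc k) acc → TailsBelow k acc
Built-tails {k} {acc} b = tailsBelow k acc
  (λ w k<w → trans (degree b w) (expected-above (λ w<1+k → <-irrefl refl (<-≤-trans k<w (≤-pred w<1+k)))))

addVertex : ∀ {j h₁ h₂ acc} → 2 ≤ j → h₁ < j → h₂ < j → ¬ h₁ ≡ h₂ → 1 ≤ h₂ → Built j acc →
            Quiet 2 acc ((j , h₁) ∷ (j , h₂) ∷ []) × Built (suc j) ((j , h₂) ∷ (j , h₁) ∷ acc)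
addVertex {j} {h₁} {h₂} {acc} 2≤j h₁<j h₂<j h₁≢h₂ 1≤h₂ b =
  (first ∷ second ∷ []) , record { downward = h₂<j ∷ h₁<j ∷ downward b ; degree = newDegree }
  where
  fresh-j : outℕ j acc ≡ 0
  fresh-j = Built-fresh b
  below : ∀ {h} → h < j → ¬ (h , j) ∈ acc
  below h<j m = <-asym h<j (∈-downward (downward b) m)
  first : QuietStep 2 acc j h₁
  first = record
    { loopless = λ e → <-irrefl (sym e) h₁<j
    ; fresh    = notTail acc fresh-j
    ; freshRev = below h₁<j
    ; tailLow  = subst (_≤ outℕ h₁ acc) (sym fresh-j) z≤n
    ; bounded  = bounded }
    where
    bounded : ∀ w → outℕ w ((j , h₁) ∷ acc) ≤ 2
    bounded w with j ℕ.≟ w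
    ... | yes refl rewrite fresh-j = s≤s z≤n
    ... | no _     rewrite degree b w = expected≤2 j w
  second : QuietStep 2 ((j , h₁) ∷ acc) j h₂
  second = record
    { loopless = λ e → <-irrefl (sym e) h₂<j
    ; fresh    = λ { (here e) → h₁≢h₂ (sym (cong proj₂ e)) ; (there m) → notTail acc fresh-j m }
    ; freshRev = λ { (here e) → <-irrefl (cong proj₁ e) h₂<j ; (there m) → below h₂<j m }
    ; tailLow  = tailLow
    ; bounded  = bounded }
    where
    tailLow : outℕ j ((j , h₁) ∷ acc) ≤ outℕ h₂ ((j , h₁) ∷ acc)
    tailLow rewrite χ-yes (j ℕ.≟ j) refl | fresh-j | χ-no (j ℕ.≟ h₂) (λ e → <-irrefl (sym e) h₂<j)
                  | degree b h₂ | expected-below h₂<j = cap-≥1 1≤h₂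
    bounded : ∀ w → outℕ w ((j , h₂) ∷ (j , h₁) ∷ acc) ≤ 2
    bounded w with j ℕ.≟ w
    ... | yes refl rewrite fresh-j = ≤-refl
    ... | no _     rewrite degree b w = expected≤2 j w
  newDegree : ∀ w → outℕ w ((j , h₂) ∷ (j , h₁) ∷ acc) ≡ expected (suc j) w
  newDegree w with j ℕ.≟ w
  ... | yes refl rewrite fresh-j | expected-below {suc j} {j} ≤-refl = sym (cap-≥2 2≤j)
  ... | no j≢w   rewrite degree b w = expected-suc j≢w

initial : List Edge
initial = (1 , 0) ∷ (2 , 0) ∷ (2 , 1) ∷ []

bandPrefix : ℕ → ℕ → List Edge
bandPrefix m zero    = []
bandPrefix m (suc k) = bandPrefix m k ++ ((suc (2 ^ m + k) , 2 ^ m + k) ∷ (suc (2 ^ m + k) , suc k) ∷ [])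

band : ℕ → List Edge
band m = bandPrefix m (2 ^ m)

bands : ℕ → List Edge
bands zero    = []
bands (suc M) = bands M ++ band (suc M)

peak : ℕ → ℕ
peak M = 2 ^ suc M

top : ℕ → ℕ
top M = suc (peak M)

final : ℕ → List Edge
final M = (top M , 0) ∷ (top M , 1) ∷ []

insertions : ℕ → List Edge
insertions M = initial ++ bands M ++ final M

beforeTop : ℕ → List Edge
beforeTop M = bands M ʳ++ (initial ʳ++ [])

afterInsertions : ℕ → List Edge
afterInsertions M = insertions M ʳ++ []

afterInsertions-≡ : ∀ M → afterInsertions M ≡ (top M , 1) ∷ (top M , 0) ∷ beforeTop M
afterInsertions-≡ M = trans (++-ʳ++ initial {bands M ++ final M}) (++-ʳ++ (bands M) {final M})

vertexOne-quiet : QuietStep 2 [] 1 0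
vertexOne-quiet = record { loopless = λ () ; fresh = λ () ; freshRev = λ () ; tailLow = z≤n
                         ; bounded = λ w → +-mono-≤ (χ≤1 (1 ℕ.≟ w)) z≤n }

vertexOne-built : Built 2 ((1 , 0) ∷ [])
vertexOne-built = record { downward = s≤s z≤n ∷ []
                         ; degree   = λ { zero → refl ; (suc zero) → refl ; (suc (suc _)) → refl } }

initial-quiet : Quiet 2 [] initial × Built 3 (initial ʳ++ [])
initial-quiet = map₁ (vertexOne-quiet ∷_) (addVertex ≤-refl (s≤s z≤n) ≤-refl (λ ()) ≤-refl vertexOne-built)

2^m+k≢1+k : ∀ {m k} → 1 ≤ m → ¬ 2 ^ m + k ≡ suc k
2^m+k≢1+k {suc m} {k} _ e = 1+n≰n (subst (2 ≤_) (+-cancelʳ-≡ k (2 ^ suc m) 1 e) (2≤2^suc m))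

bandPrefix-quiet : ∀ m k {acc} → 1 ≤ m → Built (suc (2 ^ m)) acc →
  Quiet 2 acc (bandPrefix m k) × Built (suc (2 ^ m + k)) (bandPrefix m k ʳ++ acc)
bandPrefix-quiet m zero    1≤m b rewrite +-identityʳ (2 ^ m) = [] , b
bandPrefix-quiet m (suc k) {acc} 1≤m b with bandPrefix-quiet m k 1≤m b
... | q , b′ with addVertex (s≤s (≤-trans (1≤2^ m) (m≤m+n _ k))) ≤-refl (s≤s (+-monoˡ-≤ k (1≤2^ m)))
                            (2^m+k≢1+k 1≤m) (s≤s z≤n) b′
... | q′ , b″ = Quiet-++ (bandPrefix m k) q q′ ,
                subst₂ Built (cong suc (sym (+-suc (2 ^ m) k))) (sym (++-ʳ++ (bandPrefix m k))) b″

bands-quiet : ∀ M {acc} → Built 3 acc → Quiet 2 acc (bands M) × Built (top M) (bands M ʳ++ acc)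
bands-quiet zero    b = [] , b
bands-quiet (suc M) {acc} b with bands-quiet M b
... | q , b′ with bandPrefix-quiet (suc M) (2 ^ suc M) (s≤s z≤n) b′
... | q′ , b″ = Quiet-++ (bands M) q q′ ,
                subst₂ Built (cong suc (sym (2^-suc (suc M)))) (sym (++-ʳ++ (bands M))) b″

beforeTop-built : ∀ M → Built (top M) (beforeTop M)
beforeTop-built M = proj₂ (bands-quiet M (proj₂ initial-quiet))

insertions-quiet : ∀ M → Quiet 2 [] (insertions M) × Built (suc (top M)) (afterInsertions M)
insertions-quiet M
  with addVertex {top M} (s≤s (≤-trans (s≤s z≤n) (2≤2^suc M))) (s≤s z≤n) (s≤s (1≤2^ (suc M)))
                 (λ ()) ≤-refl (beforeTop-built M)
... | q , b = Quiet-++ initial (proj₁ initial-quiet)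
                (Quiet-++ (bands M) (proj₁ (bands-quiet M (proj₂ initial-quiet))) q) ,
              subst (Built (suc (top M))) (sym (afterInsertions-≡ M)) b

inAbove-low : ∀ c w L → TailsBelow c L → inAbove c w L ≡ 0
inAbove-low c w []            []       = refl
inAbove-low c w ((a , b) ∷ L) (h ∷ hs) rewrite χ-no (c <? a) (≤⇒≯ h) | *-zeroʳ (χ (b ℕ.≟ w)) =
  inAbove-low c w L hs

inAbove-++ : ∀ c w xs ys → inAbove c w (xs ++ ys) ≡ inAbove c w xs + inAbove c w ys
inAbove-++ c w = weight-++ (λ e → χ (proj₂ e ℕ.≟ w) * χ (c <? proj₁ e))

-- The predecessor edge x + 1 → x of a band vertex never counts as an edge
-- into w < J from above J: if its head x is w, its tail x + 1 is at most J.
predecessor-silent : ∀ x J w → w < J → χ (x ℕ.≟ w) * χ (J <? suc x) ≡ 0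
predecessor-silent x J w w<J with x ℕ.≟ w
... | no _     = refl
... | yes refl rewrite χ-no (J <? suc x) (λ J<1+x → <-irrefl refl (<-≤-trans w<J (≤-pred J<1+x))) = refl

bandPrefix-step : ∀ m k J w → w < J →
  inAbove J w (bandPrefix m (suc k)) ≡ inAbove J w (bandPrefix m k) + χ (suc k ℕ.≟ w) * χ (J <? suc (2 ^ m + k))
bandPrefix-step m k J w w<J
  rewrite inAbove-++ J w (bandPrefix m k) ((suc (2 ^ m + k) , 2 ^ m + k) ∷ (suc (2 ^ m + k) , suc k) ∷ [])
        | predecessor-silent (2 ^ m + k) J w w<J = cong (inAbove J w (bandPrefix m k) +_) (+-identityʳ _)

-- A vertex w < J receives at most one edge from above J in a band, namely
-- the edge 2^m + w → w, and only when J < 2^m + w.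
band-atMostOne : ∀ m k J w → w < J →
  inAbove J w (bandPrefix m k) ≡ 0 ⊎ (inAbove J w (bandPrefix m k) ≡ 1 × w ≤ k × J < 2 ^ m + w)
band-atMostOne m zero    J w w<J = inj₁ refl
band-atMostOne m (suc k) J w w<J rewrite bandPrefix-step m k J w w<J =
  extend (suc k ℕ.≟ w) (J <? suc (2 ^ m + k)) (band-atMostOne m k J w w<J)
  where
  X : ℕ
  X = inAbove J w (bandPrefix m k)
  extend : Dec (suc k ≡ w) → Dec (J < suc (2 ^ m + k)) →
           X ≡ 0 ⊎ (X ≡ 1 × w ≤ k × J < 2 ^ m + w) →
           let Y = X + χ (suc k ℕ.≟ w) * χ (J <? suc (2 ^ m + k)) in
           Y ≡ 0 ⊎ (Y ≡ 1 × w ≤ suc k × J < 2 ^ m + w)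
  extend (yes refl) _ (inj₂ (_ , 1+k≤k , _)) = ⊥-elim (1+n≰n 1+k≤k)
  extend (yes refl) (yes J<) (inj₁ X≡0) rewrite X≡0 | χ-yes (suc k ℕ.≟ suc k) refl | χ-yes (J <? suc (2 ^ m + k)) J< =
    inj₂ (refl , ≤-refl , subst (J <_) (sym (+-suc (2 ^ m) k)) J<)
  extend (yes refl) (no J≮) (inj₁ X≡0) rewrite X≡0 | χ-no (J <? suc (2 ^ m + k)) J≮ | *-zeroʳ (χ (suc k ℕ.≟ suc k)) =
    inj₁ refl
  extend (no 1+k≢w) _ r rewrite χ-no (suc k ℕ.≟ w) 1+k≢w | +-identityʳ X with r
  ... | inj₁ X≡0              = inj₁ X≡0
  ... | inj₂ (X≡1 , w≤k , J<) = inj₂ (X≡1 , m≤n⇒m≤1+n w≤k , J<)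

-- Every 1 ≤ J ≤ k receives the edge 2^m + J → J, whose tail is above J.
band-reachesLow : ∀ m k J → 1 ≤ J → J ≤ k → 1 ≤ inAbove J J (bandPrefix m k)
band-reachesLow m zero    zero    () z≤n
band-reachesLow m (suc k) J 1≤J J≤1+k
  rewrite inAbove-++ J J (bandPrefix m k) ((suc (2 ^ m + k) , 2 ^ m + k) ∷ (suc (2 ^ m + k) , suc k) ∷ [])
  with suc k ℕ.≟ J
... | yes refl rewrite χ-yes (suc k <? suc (2 ^ m + k)) (s≤s (+-monoˡ-≤ k (1≤2^ m))) =
  ≤-trans (m≤n+m 1 _) (m≤n+m _ (inAbove (suc k) (suc k) (bandPrefix m k)))
... | no 1+k≢J = ≤-trans (band-reachesLow m k J 1≤J (≤-pred (≤∧≢⇒< J≤1+k (λ e → 1+k≢J (sym e)))))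
                         (m≤m+n _ _)

-- Every 2^m ≤ J < 2^m + k receives the edge J + 1 → J.
band-reachesHigh : ∀ m k J → 2 ^ m ≤ J → J < 2 ^ m + k → 1 ≤ inAbove J J (bandPrefix m k)
band-reachesHigh m zero    J 2^m≤J J<2^m+0 =
  ⊥-elim (<-irrefl refl (≤-<-trans 2^m≤J (subst (J <_) (+-identityʳ (2 ^ m)) J<2^m+0)))
band-reachesHigh m (suc k) J 2^m≤J J<
  rewrite inAbove-++ J J (bandPrefix m k) ((suc (2 ^ m + k) , 2 ^ m + k) ∷ (suc (2 ^ m + k) , suc k) ∷ [])
  with 2 ^ m + k ℕ.≟ J
... | yes refl rewrite χ-yes (2 ^ m + k <? suc (2 ^ m + k)) ≤-refl =
  ≤-trans (s≤s z≤n) (m≤n+m _ (inAbove (2 ^ m + k) (2 ^ m + k) (bandPrefix m k)))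
... | no x≢J = ≤-trans (band-reachesHigh m k J 2^m≤J
                          (≤∧≢⇒< (≤-pred (subst (J <_) (+-suc (2 ^ m) k) J<)) (λ e → x≢J (sym e))))
                       (m≤m+n _ _)

band-dominated : ∀ m J w → w < J → inAbove J w (band m) ≤ inAbove J J (band m)
band-dominated m J w w<J with band-atMostOne m (2 ^ m) J w w<J
... | inj₁ zero≡ rewrite zero≡ = z≤n
... | inj₂ (one≡ , w≤2^m , J<2^m+w) rewrite one≡ with J ≤? 2 ^ m
...   | yes J≤2^m = band-reachesLow m (2 ^ m) J (≤-trans (s≤s z≤n) w<J) J≤2^m
...   | no  J≰2^m = band-reachesHigh m (2 ^ m) J (<⇒≤ (≰⇒> J≰2^m))
                      (<-≤-trans J<2^m+w (+-monoʳ-≤ (2 ^ m) w≤2^m))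

bands-dominated : ∀ M J w → w < J → inAbove J w (bands M) ≤ inAbove J J (bands M)
bands-dominated zero    J w _   = z≤n
bands-dominated (suc M) J w w<J
  rewrite inAbove-++ J w (bands M) (band (suc M)) | inAbove-++ J J (bands M) (band (suc M)) =
  +-mono-≤ (bands-dominated M J w w<J) (band-dominated (suc M) J w w<J)

bands-reach : ∀ M J → 2 ≤ J → J < peak M → 1 ≤ inAbove J J (bands M)
bands-reach zero    J (s≤s (s≤s _)) (s≤s (s≤s ()))
bands-reach (suc M) J 2≤J J<
  rewrite inAbove-++ J J (bands M) (band (suc M))
  with J <? peak M
... | yes J<peak = ≤-trans (bands-reach M J 2≤J J<peak) (m≤m+n _ _)
... | no  J≮peak = ≤-trans (band-reachesHigh (suc M) (2 ^ suc M) J (≮⇒≥ J≮peak)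
                             (subst (J <_) (2^-suc (suc M)) J<))
                           (m≤n+m _ _)

-- Vertex 2 receives two edges from above in band 1 and one in every later
-- band: M + 1 in total.
bands-intoTwo : ∀ M → 1 ≤ M → suc M ≤ inAbove 2 2 (bands M)
bands-intoTwo (suc zero)    _ = s≤s (s≤s z≤n)
bands-intoTwo (suc (suc M)) _ = begin
  suc (suc (suc M))                                               ≡⟨ +-comm 1 (suc (suc M)) ⟩
  suc (suc M) + 1                                                 ≤⟨ +-mono-≤ (bands-intoTwo (suc M) (s≤s z≤n)) reachesTwo ⟩
  inAbove 2 2 (bands (suc M)) + inAbove 2 2 (band (suc (suc M)))  ≡⟨ sym (inAbove-++ 2 2 (bands (suc M)) _) ⟩
  inAbove 2 2 (bands (suc (suc M)))                               ∎
  where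
  open ≤-Reasoning
  reachesTwo : 1 ≤ inAbove 2 2 (band (suc (suc M)))
  reachesTwo = band-reachesLow (suc (suc M)) (2 ^ suc (suc M)) 2 (s≤s z≤n) (2≤2^suc (suc M))

-- Vertex 2 receives at least M + 1 edges from above among the bands and the
-- last edge (which ends at 2 when M = 0).
two-surplus : ∀ M → suc M ≤ χ (peak M ℕ.≟ 2) + inAbove 2 2 (bands M)
two-surplus zero    = ≤-refl
two-surplus (suc M) = ≤-trans (bands-intoTwo (suc M) (s≤s z≤n)) (m≤n+m _ _)

module Cascade (M : ℕ) where

  t p : ℕ
  t = top M
  p = peak M

  p<t : p < t
  p<t = ≤-refl

  2≤p : 2 ≤ p
  2≤p = 2≤2^suc M

  s : List Edge
  s = afterInsertions M

  s-built : Built (suc t) s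
  s-built = proj₂ (insertions-quiet M)

  E : List Edge
  E = (t , p) ∷ s

  E-downward : Downward E
  E-downward = p<t ∷ downward s-built

  E-tails : TailsBelow t E
  E-tails = ≤-refl ∷ Built-tails s-built

  outℕ-E : ∀ w → outℕ w E ≡ χ (t ℕ.≟ w) + expected (suc t) w
  outℕ-E w = cong (χ (t ℕ.≟ w) +_) (degree s-built w)

  outℕ-E≤3 : ∀ w → outℕ w E ≤ 3
  outℕ-E≤3 w rewrite outℕ-E w = +-mono-≤ (χ≤1 (t ℕ.≟ w)) (expected≤2 (suc t) w)

  outℕ-E-below : ∀ {w} → w < t → outℕ w E ≡ cap w
  outℕ-E-below {w} w<t rewrite outℕ-E w | χ-no (t ℕ.≟ w) (λ e → <-irrefl (sym e) w<t) =
    expected-below (m≤n⇒m≤1+n w<t)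

  weight-E : ∀ f → weight f E ≡ f (t , p) + (weight f initial + (weight f (bands M) + weight f (final M)))
  weight-E f = cong (f (t , p) +_) (begin
    weight f (insertions M ʳ++ [])                         ≡⟨ weight-ʳ++ f (insertions M) [] ⟩
    weight f (insertions M) + 0                            ≡⟨ +-identityʳ _ ⟩
    weight f (initial ++ bands M ++ final M)               ≡⟨ weight-++ f initial (bands M ++ final M) ⟩
    weight f initial + weight f (bands M ++ final M)       ≡⟨ cong (weight f initial +_) (weight-++ f (bands M) (final M)) ⟩
    weight f initial + (weight f (bands M) + weight f (final M)) ∎)
    where open ≡-Reasoning

  inAbove-E : ∀ J w → 2 ≤ J → J < t →
              inAbove J w E ≡ χ (p ℕ.≟ w) + (inAbove J w (bands M) + (χ (0 ℕ.≟ w) + χ (1 ℕ.≟ w)))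
  inAbove-E J w 2≤J J<t
    rewrite weight-E (λ e → χ (proj₂ e ℕ.≟ w) * χ (J <? proj₁ e))
          | inAbove-low J w initial (≤-trans (s≤s z≤n) 2≤J ∷ 2≤J ∷ 2≤J ∷ [])
          | χ-yes (J <? t) J<t
          | *-identityʳ (χ (p ℕ.≟ w)) | *-identityʳ (χ (0 ℕ.≟ w)) | *-identityʳ (χ (1 ℕ.≟ w))
          | +-identityʳ (χ (1 ℕ.≟ w)) = refl

  -- Vertices 0 and 1 gain the top vertex's edges but have small caps.
  cap+final≤2 : ∀ w → cap w + (χ (0 ℕ.≟ w) + χ (1 ℕ.≟ w)) ≤ 2
  cap+final≤2 zero          = s≤s z≤n
  cap+final≤2 (suc zero)    = ≤-refl
  cap+final≤2 (suc (suc w)) = ≤-refl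

  pivot-lower : ∀ J → 2 ≤ J → J ≤ p →
                2 + (χ (p ℕ.≟ J) + inAbove J J (bands M)) ≤ outℕ J (resetAbove J E)
  pivot-lower J 2≤J J≤p = begin
    2 + (χ (p ℕ.≟ J) + inAbove J J (bands M))          ≤⟨ +-monoʳ-≤ 2 (+-monoʳ-≤ (χ (p ℕ.≟ J)) (m≤m+n _ _)) ⟩
    2 + (χ (p ℕ.≟ J) + (inAbove J J (bands M) + _))    ≡⟨ cong₂ _+_ (sym (trans (outℕ-E-below J<t) (cap-≥2 2≤J)))
                                                                     (sym (inAbove-E J J 2≤J J<t)) ⟩
    outℕ J E + inAbove J J E                           ≡⟨ sym (outℕ-resetAbove-low J J E E-downward ≤-refl) ⟩
    outℕ J (resetAbove J E)                            ∎
    where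
    open ≤-Reasoning
    J<t : J < t
    J<t = ≤-<-trans J≤p p<t

  below-upper : ∀ J n → 2 ≤ J → J ≤ p → n < J → outℕ n (resetAbove J E) ≤ 2 + inAbove J n (bands M)
  below-upper J n 2≤J J≤p n<J = begin
    outℕ n (resetAbove J E)                                          ≡⟨ outℕ-resetAbove-low J n E E-downward (<⇒≤ n<J) ⟩
    outℕ n E + inAbove J n E                                         ≡⟨ cong₂ _+_ (outℕ-E-below n<t) (inAbove-E J n 2≤J J<t) ⟩
    cap n + (χ (p ℕ.≟ n) + (inAbove J n (bands M) + final-n))        ≡⟨ cong (λ x → cap n + (x + (inAbove J n (bands M) + final-n))) (χ-no (p ℕ.≟ n) p≢n) ⟩
    cap n + (inAbove J n (bands M) + final-n)                        ≡⟨ cong (cap n +_) (+-comm _ final-n) ⟩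
    cap n + (final-n + inAbove J n (bands M))                        ≡⟨ sym (+-assoc (cap n) final-n _) ⟩
    (cap n + final-n) + inAbove J n (bands M)                        ≤⟨ +-monoˡ-≤ _ (cap+final≤2 n) ⟩
    2 + inAbove J n (bands M)                                        ∎
    where
    open ≤-Reasoning
    final-n : ℕ
    final-n = χ (0 ℕ.≟ n) + χ (1 ℕ.≟ n)
    J<t : J < t
    J<t = ≤-<-trans J≤p p<t
    n<t : n < t
    n<t = <-trans n<J J<t
    p≢n : ¬ p ≡ n
    p≢n p≡n = <-irrefl refl (<-≤-trans n<J (subst (J ≤_) p≡n J≤p))

  pivot-surplus : ∀ J → 2 ≤ J → J ≤ p → 1 ≤ χ (p ℕ.≟ J) + inAbove J J (bands M)
  pivot-surplus J 2≤J J≤p with J <? p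
  ... | yes J<p = ≤-trans (bands-reach M J 2≤J J<p) (m≤n+m _ _)
  ... | no  J≮p rewrite ≤-antisym J≤p (≮⇒≥ J≮p) | χ-yes (p ℕ.≟ p) refl = s≤s z≤n

  IsPivot : ℕ → Set
  IsPivot J = 3 ≤ outℕ J (resetAbove J E) × (∀ n → outℕ n (resetAbove J E) ≤ outℕ J (resetAbove J E))

  -- Levels 3 ≤ J ≤ p: vertices below J are dominated band by band, vertices
  -- above J have out-degree at most 3.
  pivot-inner : ∀ J → 3 ≤ J → J ≤ p → IsPivot J
  pivot-inner J 3≤J J≤p = ≤-trans (+-monoʳ-≤ 2 (pivot-surplus J 2≤J J≤p)) lower , maximal
    where
    2≤J : 2 ≤ J
    2≤J = ≤-trans (n≤1+n 2) 3≤J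
    lower : 2 + (χ (p ℕ.≟ J) + inAbove J J (bands M)) ≤ outℕ J (resetAbove J E)
    lower = pivot-lower J 2≤J J≤p
    maximal : ∀ n → outℕ n (resetAbove J E) ≤ outℕ J (resetAbove J E)
    maximal n with <-cmp n J
    ... | tri≈ _ refl _ = ≤-refl
    ... | tri< n<J _ _ = ≤-trans (below-upper J n 2≤J J≤p n<J)
                           (≤-trans (+-monoʳ-≤ 2 (≤-trans (bands-dominated M J n n<J) (m≤n+m _ _))) lower)
    ... | tri> _ _ J<n = ≤-trans (outℕ-resetAbove-high J n E E-downward J<n)
                           (≤-trans (outℕ-E≤3 n) (≤-trans (+-monoʳ-≤ 2 (pivot-surplus J 2≤J J≤p)) lower))

  -- Level t: nothing has been reset, the top vertex has out-degree 3, the maximum.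
  pivot-top : IsPivot t
  pivot-top = subst (λ L → 3 ≤ outℕ t L × (∀ n → outℕ n L ≤ outℕ t L)) (sym (resetAbove-top t E E-tails))
                    (≤-reflexive (sym top-degree) , λ n → subst (outℕ n E ≤_) (sym top-degree) (outℕ-E≤3 n))
    where
    top-degree : outℕ t E ≡ 3
    top-degree rewrite outℕ-E t | χ-yes (t ℕ.≟ t) refl | expected-below {suc t} {t} ≤-refl
                     | cap-≥2 {t} (≤-trans 2≤p (n≤1+n p)) = refl

  pivot : ∀ J → 3 ≤ J → J ≤ t → IsPivot J
  pivot J 3≤J J≤t with J ≤? p
  ... | yes J≤p = pivot-inner J 3≤J J≤p
  ... | no  J≰p rewrite ≤-antisym J≤t (≰⇒> J≰p) = pivot-top

  two-value : 3 + M ≤ outℕ 2 (resetAbove 2 E)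
  two-value = ≤-trans (+-monoʳ-≤ 2 (two-surplus M)) (pivot-lower 2 ≤-refl 2≤p)

top≤2^ : ∀ i → 2 ≤ i → top (i ∸ 3) ≤ 2 ^ i
top≤2^ (suc zero)    (s≤s ())
top≤2^ (suc (suc j)) _ =
  ≤-trans (s≤s (^-monoʳ-≤ 2 (s≤s (m∸n≤m j 1))))
          (subst (suc (2 ^ suc j) ≤_) (sym (2^-suc (suc j))) (+-monoˡ-≤ (2 ^ suc j) (1≤2^ (suc j))))

module Final (i : ℕ) (2≤i : 2 ≤ i) where
  open Embedding (2 ^ i)
  open QuietRun (2 ^ i)
  open Cascade (i ∸ 3)

  M : ℕ
  M = i ∸ 3

  t≤2^i : t ≤ 2 ^ i
  t≤2^i = top≤2^ i 2≤i

  E-inRange : InRange E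
  E-inRange = All.map (λ (a≤t , b<a) → ≤-trans a≤t t≤2^i , ≤-trans (<⇒≤ b<a) (≤-trans a≤t t≤2^i))
                      (All.zip (E-tails , E-downward))

  s-inRange : InRange s
  s-inRange = All.tail E-inRange

  resetAbove-inRange : ∀ c → InRange (resetAbove c E)
  resetAbove-inRange c = map⁺ (All.map (λ {e} → swapOrKeep e) E-inRange)
    where
    swapOrKeep : ∀ e → proj₁ e ≤ 2 ^ i × proj₂ e ≤ 2 ^ i →
                 proj₁ (orientAt c e) ≤ 2 ^ i × proj₂ (orientAt c e) ≤ 2 ^ i
    swapOrKeep (a , b) (a≤ , b≤) with orientAt c (a , b) | orientAt-endpoints c a b
    ... | _ | inj₁ refl = a≤ , b≤
    ... | _ | inj₂ refl = b≤ , a≤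

  run : BFRun 2 [] (embed (insertions M)) (embed s)
  run = quiet⇒BFRun (insertions M) [] (All-ʳ++ (insertions M) s-inRange) [] (proj₁ (insertions-quiet M))

  arboricity : ArboricityAtMost 2 (embed (insertions M))
  arboricity = arboricity-embed 2 (insertions M) (All-ʳ++ (insertions M) s-inRange)
                 (All-ʳ++ (insertions M) (downward s-built)) out≤2
    where
    out≤2 : ∀ w → outℕ w (insertions M) ≤ 2
    out≤2 w = subst (_≤ 2) (trans (sym (degree s-built w)) (trans (weight-ʳ++ _ (insertions M) []) (+-identityʳ _)))
                    (expected≤2 (suc t) w)

  -- The last insertion: top and peak both have out-degree 2, so the edge may
  -- be oriented top → peak.
  lastInsert : InsertStep (embed s) (vtx t , vtx p) (embed E)
  lastInsert = orient-uv distinct nonAdjacent (≤-reflexive equalDegrees)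
    where
    p≤2^i : p ≤ 2 ^ i
    p≤2^i = ≤-trans (<⇒≤ p<t) t≤2^i
    distinct : ¬ vtx t ≡ vtx p
    distinct e = <-irrefl (sym (vtx-injective t≤2^i p≤2^i e)) p<t
    absent : ¬ (t , p) ∈ s
    absent rewrite afterInsertions-≡ M = λ where
      (here e)          → 1+n≰n (subst (2 ≤_) (cong proj₂ e) 2≤p)
      (there (here e))  → 1+n≰n (≤-trans (subst (2 ≤_) (cong proj₂ e) 2≤p) z≤n)
      (there (there m)) → notTail (beforeTop M) (Built-fresh (beforeTop-built M)) m
    nonAdjacent : ¬ Adjacent (embed s) (vtx t) (vtx p)
    nonAdjacent (inj₁ m) = absent (∈-embed s-inRange t≤2^i p≤2^i m)
    nonAdjacent (inj₂ m) = <-asym p<t (∈-downward (downward s-built) (∈-embed s-inRange p≤2^i t≤2^i m))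
    degree-2 : ∀ {w} → 2 ≤ w → w ≤ t → w ≤ 2 ^ i → outdeg (embed s) (vtx w) ≡ 2
    degree-2 {w} 2≤w w≤t w≤2^i rewrite outdeg-embed s s-inRange (vtx w) | toℕ-toFin (2 ^ i) w w≤2^i
                                     | degree s-built w | expected-below {suc t} {w} (s≤s w≤t) = cap-≥2 2≤w
    equalDegrees : outdeg (embed s) (vtx t) ≡ outdeg (embed s) (vtx p)
    equalDegrees = trans (degree-2 (≤-trans 2≤p (n≤1+n p)) ≤-refl t≤2^i) (sym (degree-2 2≤p (<⇒≤ p<t) p≤2^i))

  outdeg-level : ∀ c w → outdeg (embed (resetAbove c E)) w ≡ outℕ (toℕ w) (resetAbove c E)
  outdeg-level c = outdeg-embed (resetAbove c E) (resetAbove-inRange c)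

  cascadeStep : ∀ c → 2 ≤ c → suc c ≤ t → ResetStep 2 (embed (resetAbove (suc c) E)) (embed (resetAbove c E))
  cascadeStep c 2≤c c<t = vtx (suc c) , exceeds , maximal , resets
    where
    c+1≤2^i : suc c ≤ 2 ^ i
    c+1≤2^i = ≤-trans c<t t≤2^i
    level : IsPivot (suc c)
    level = pivot (suc c) (s≤s 2≤c) c<t
    exceeds : 2 < outdeg (embed (resetAbove (suc c) E)) (vtx (suc c))
    exceeds rewrite outdeg-level (suc c) (vtx (suc c)) | toℕ-toFin (2 ^ i) (suc c) c+1≤2^i = proj₁ level
    maximal : ∀ w → 2 < outdeg (embed (resetAbove (suc c) E)) w →
              outdeg (embed (resetAbove (suc c) E)) w ≤ outdeg (embed (resetAbove (suc c) E)) (vtx (suc c))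
    maximal w _ rewrite outdeg-level (suc c) w | outdeg-level (suc c) (vtx (suc c))
                      | toℕ-toFin (2 ^ i) (suc c) c+1≤2^i = proj₂ level (toℕ w)
    resets : embed (resetAbove c E) ≡ reset (embed (resetAbove (suc c) E)) (vtx (suc c))
    resets = sym (trans (reset-embed (resetAbove (suc c) E) (resetAbove-inRange (suc c)) (suc c) c+1≤2^i)
                        (cong embed (resetAbove-step c E E-downward)))

  cascadeFrom : ∀ k → k + 2 ≤ t → CascadePrefix 2 (embed (resetAbove (k + 2) E)) (embed (resetAbove 2 E))
  cascadeFrom zero    _   = done
  cascadeFrom (suc k) k+3≤t = step (cascadeStep (k + 2) (m≤n+m 2 k) k+3≤t) (cascadeFrom k (≤-trans (n≤1+n _) k+3≤t))

  cascade : CascadePrefix 2 (embed E) (embed (resetAbove 2 E))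
  cascade = subst (λ L → CascadePrefix 2 (embed L) (embed (resetAbove 2 E)))
                  (trans (cong (λ c → resetAbove c E) (m∸n+n≡m 2≤t)) (resetAbove-top t E E-tails))
                  (cascadeFrom (t ∸ 2) (≤-reflexive (m∸n+n≡m 2≤t)))
    where
    2≤t : 2 ≤ t
    2≤t = ≤-trans 2≤p (n≤1+n p)

  blowup : i ≤ outdeg (embed (resetAbove 2 E)) (vtx 2)
  blowup rewrite outdeg-level 2 (vtx 2) | toℕ-toFin (2 ^ i) 2 (≤-trans 2≤p (≤-trans (<⇒≤ p<t) t≤2^i)) =
    ≤-trans (m≤n+m∸n i 3) two-value

corollary1 : ∀ (i : ℕ) → 2 ≤ i →
    Σ[ ins ∈ List (Fin (suc (2 ^ i)) × Fin (suc (2 ^ i))) ]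
    Σ[ last ∈ Fin (suc (2 ^ i)) × Fin (suc (2 ^ i)) ]
      ArboricityAtMost 2 ins
      × (∃[ s ] BFRun 2 [] ins s
          × ∃[ s₁ ] InsertStep s last s₁
          × ∃[ s₂ ] CascadePrefix 2 s₁ s₂
          × ∃[ v ] i ≤ outdeg s₂ v)
corollary1 i 2≤i =
  embed (insertions M) , (vtx t , vtx p) , arboricity ,
  embed s , run , embed E , lastInsert , embed (resetAbove 2 E) , cascade , vtx 2 , blowup
  where
  open Final i 2≤i
  open Embedding (2 ^ i)
  open Cascade (i ∸ 3)
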